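{- If $r\in\mathsf{SN}$, then $\lambda x^A.r\in\mathsf{SN}$.
   Context: Types are generated by $A ::= \tau \mid A\Rightarrow A \mid A\wedge A$, where $\tau$ is the only atomic type ($\Rightarrow$ associates to the right). Type equivalence $\equiv$ is the smallest congruence on types such that $A\wedge B\equiv B\wedge A$, $A\wedge(B\wedge C)\equiv(A\wedge B)\wedge C$, $A\Rightarrow(B\wedge C)\equiv(A\Rightarrow B)\wedge(A\Rightarrow C)$ and $(A\wedge B)\Rightarrow C\equiv A\Rightarrow B\Rightarrow C$. To each type $A$ is associated an infinite set of variables $\mathcal V_A$, with $\mathcal V_A=\mathcal V_B$ if $A\equiv B$ and $\mathcal V_A\cap\mathcal V_B=\emptyset$ otherwise. Preterms are $r ::= x \mid \lambda x.r \mid rr \mid r\times r \mid \pi_A(r)$ (application left associative); one writes $\lambda x^A.r$ for $\lambda x.r$ when $x\in\mathcal V_A$. Introductions are abstractions and products; eliminations are applications and projections. Typing $r:A$ (without contexts): $x:A$ if $x\in\mathcal V_A$; if $r:A$ and $A\equiv B$ then $r:B$; if $r:B$ then $\lambda x^A.r:A\Rightarrow B$; if $r:A\Rightarrow B$ and $s:A$ then $rs:B$; if $r:A$ and $s:B$ then $r\times s:A\wedge B$; if $r:A\wedge B$ then $\pi_A(r):A$. Terms are well-typed preterms. $\rightleftarrows$ is the smallest symmetric relation, closed under all term contexts, containing $r\times s\rightleftarrows s\times r$, $(r\times s)\times t\rightleftarrows r\times(s\times t)$, $\lambda x^A.(r\times s)\rightleftarrows \lambda x^A.r\times\lambda x^A.s$,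 $rst\rightleftarrows r(s\times t)$; $\rightleftarrows^*$ is its reflexive transitive closure. Reduction: $\to_{\beta\pi\zeta}$: if $s:A$ then $(\lambda x^A.r)s\to_{\beta\pi\zeta} r[s/x]$; if $r:A$ then $\pi_A(r\times s)\to_{\beta\pi\zeta} r$; $(r\times s)t\to_{\beta\pi\zeta} rt\times st$. $\to_{\eta\delta}$: if $r:A\Rightarrow B$, $r$ is an elimination or a variable, and $x\in\mathcal V_A$ fresh, then $r\to_{\eta\delta}\lambda x^A.(rx)$; if $r:A\wedge B$ and $r$ is an elimination or a variable, then $r\to_{\eta\delta}\pi_A(r)\times\pi_B(r)$. The relations $\hookrightarrow$ and $\to$ are the smallest relations such that: $r\to_{\beta\pi\zeta}s$ implies $r\hookrightarrow s$; $r\to_{\eta\delta}s$ implies $r\to s$; $r\hookrightarrow s$ implies $r\to s$; $r\to s$ implies $\lambda x.r\hookrightarrow\lambda x.s$; $r\hookrightarrow s$ implies $rt\hookrightarrow st$; $r\to s$ implies $tr\hookrightarrow ts$, $r\times t\hookrightarrow s\times t$, $t\times r\hookrightarrow t\times s$; $r\hookrightarrow s$ implies $\pi_A(r)\hookrightarrow\pi_A(s)$. $r\rightsquigarrow s$ iff $r\rightleftarrows^* r'\to s'\rightleftarrows^* s$ for some $r',s'$. $\mathsf{SN}$ is the set of terms $r$ admitting no infinite sequence $r\rightsquigarrow r_1\rightsquigarrow r_2\rightsquigarrow\cdots$. -}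

module Defs where

open import Data.Nat using (ℕ; zero; suc; pred; _<ᵇ_; _≡ᵇ_)
import Data.Nat as ℕ
open import Data.Bool using (if_then_else_)
open import Data.List using (List; []; _∷_)
open import Data.Product using (Σ; _×_; _,_; proj₁)
open import Data.Product.Properties using (≡-dec)
open import Relation.Nullary using (¬_; Dec; yes; no)
open import Relation.Nullary.Decidable using (⌊_⌋)
open import Relation.Binary.PropositionalEquality using (_≡_; refl; cong₂)
open import Relation.Binary.Construct.Closure.ReflexiveTransitive using (Star)

infixr 7 _⇒_
infixr 8 _∧_

data Ty : Set where
  τ   : Ty
  _⇒_ : Ty → Ty → Ty
  _∧_ : Ty → Ty → Ty

infix 4 _≈_
data _≈_ : Ty → Ty → Set where
  ≈-refl  : ∀ {A} → A ≈ A
  ≈-sym   : ∀ {A B} → A ≈ B → B ≈ A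
  ≈-trans : ∀ {A B C} → A ≈ B → B ≈ C → A ≈ C
  ≈-⇒     : ∀ {A A' B B'} → A ≈ A' → B ≈ B' → (A ⇒ B) ≈ (A' ⇒ B')
  ≈-∧     : ∀ {A A' B B'} → A ≈ A' → B ≈ B' → (A ∧ B) ≈ (A' ∧ B')
  ∧-comm  : ∀ {A B} → (A ∧ B) ≈ (B ∧ A)
  ∧-assoc : ∀ {A B C} → (A ∧ (B ∧ C)) ≈ ((A ∧ B) ∧ C)
  ⇒-dist  : ∀ {A B C} → (A ⇒ (B ∧ C)) ≈ ((A ⇒ B) ∧ (A ⇒ C))
  ⇒-curry : ∀ {A B C} → ((A ∧ B) ⇒ C) ≈ (A ⇒ B ⇒ C)

_≟Ty_ : (A B : Ty) → Dec (A ≡ B)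
τ ≟Ty τ = yes refl
τ ≟Ty (_ ⇒ _) = no (λ ())
τ ≟Ty (_ ∧ _) = no (λ ())
(_ ⇒ _) ≟Ty τ = no (λ ())
(_ ⇒ _) ≟Ty (_ ∧ _) = no (λ ())
(_ ∧ _) ≟Ty τ = no (λ ())
(_ ∧ _) ≟Ty (_ ⇒ _) = no (λ ())
(A ⇒ B) ≟Ty (C ⇒ D) with A ≟Ty C | B ≟Ty D
... | yes refl | yes refl = yes refl
... | no p | _ = no (λ { refl → p refl })
... | yes _ | no q = no (λ { refl → q refl })
(A ∧ B) ≟Ty (C ∧ D) with A ≟Ty C | B ≟Ty D
... | yes refl | yes refl = yes refl
... | no p | _ = no (λ { refl → p refl })
... | yes _ | no q = no (λ { refl → q refl })

-- Variables.  A (free) variable is a pair (B , n); it belongs to V_A iff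
-- B ≈ A.  Hence each V_A is infinite, V_A = V_B when A ≈ B, and V_A, V_B
-- are disjoint otherwise.

Var : Set
Var = Ty × ℕ

infix 4 _∈V_
_∈V_ : Var → Ty → Set
x ∈V A = proj₁ x ≈ A

_≟V_ : (x y : Var) → Dec (x ≡ y)
_≟V_ = ≡-dec _≟Ty_ ℕ._≟_

-- Preterms (locally nameless-style: free variables are named, bound
-- variables are de Bruijn indices; ƛ A r is λx^A.r).

infixl 9 _·_
infixr 6 _⊗_

data Tm : Set where
  fv  : Var → Tm
  bv  : ℕ → Tm
  ƛ   : Ty → Tm → Tm
  _·_ : Tm → Tm → Tm
  _⊗_ : Tm → Tm → Tm
  π   : Ty → Tm → Tm

shift : ℕ → Tm → Tm
shift c (fv x)  = fv x
shift c (bv i)  = if i <ᵇ c then bv i else bv (suc i)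
shift c (ƛ A r) = ƛ A (shift (suc c) r)
shift c (r · s) = shift c r · shift c s
shift c (r ⊗ s) = shift c r ⊗ shift c s
shift c (π A r) = π A (shift c r)

shiftBy : ℕ → Tm → Tm
shiftBy zero s    = s
shiftBy (suc k) s = shift 0 (shiftBy k s)

subst : ℕ → Tm → Tm → Tm
subst k s (fv x)  = fv x
subst k s (bv i)  = if i <ᵇ k then bv i else (if i ≡ᵇ k then shiftBy k s else bv (pred i))
subst k s (ƛ A r) = ƛ A (subst (suc k) s r)
subst k s (r · t) = subst k s r · subst k s t
subst k s (r ⊗ t) = subst k s r ⊗ subst k s t
subst k s (π A r) = π A (subst k s r)

_[_] : Tm → Tm → Tm
r [ s ] = subst 0 s r

close : ℕ → Var → Tm → Tm
close k x (fv y)  = if ⌊ y ≟V x ⌋ then bv k else fv y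
close k x (bv i)  = bv i
close k x (ƛ A r) = ƛ A (close (suc k) x r)
close k x (r · s) = close k x r · close k x s
close k x (r ⊗ s) = close k x r ⊗ close k x s
close k x (π A r) = π A (close k x r)

-- Typing.  Contexts only record the types of bound variables (de Bruijn);
-- free variables are typed by the set V_A they belong to.

Ctx : Set
Ctx = List Ty

infix 4 _∋_∶_
data _∋_∶_ : Ctx → ℕ → Ty → Set where
  here  : ∀ {Γ A} → (A ∷ Γ) ∋ zero ∶ A
  there : ∀ {Γ A B i} → Γ ∋ i ∶ A → (B ∷ Γ) ∋ suc i ∶ A

infix 4 _⊢_∶_
data _⊢_∶_ (Γ : Ctx) : Tm → Ty → Set where
  ty-fv   : ∀ {x A} → x ∈V A → Γ ⊢ fv x ∶ A
  ty-bv   : ∀ {i A} → Γ ∋ i ∶ A → Γ ⊢ bv i ∶ A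
  ty-conv : ∀ {r A B} → Γ ⊢ r ∶ A → A ≈ B → Γ ⊢ r ∶ B
  ty-ƛ    : ∀ {r A B} → (A ∷ Γ) ⊢ r ∶ B → Γ ⊢ ƛ A r ∶ A ⇒ B
  ty-·    : ∀ {r s A B} → Γ ⊢ r ∶ A ⇒ B → Γ ⊢ s ∶ A → Γ ⊢ r · s ∶ B
  ty-⊗    : ∀ {r s A B} → Γ ⊢ r ∶ A → Γ ⊢ s ∶ B → Γ ⊢ r ⊗ s ∶ A ∧ B
  ty-π    : ∀ {r A B} → Γ ⊢ r ∶ A ∧ B → Γ ⊢ π A r ∶ A

Term : Tm → Set
Term r = Σ Ty (λ A → [] ⊢ r ∶ A)

infix 4 _⇄₀_ _⇄_
data _⇄₀_ : Tm → Tm → Set where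
  ⇄-comm  : ∀ {r s} → (r ⊗ s) ⇄₀ (s ⊗ r)
  ⇄-assoc : ∀ {r s t} → ((r ⊗ s) ⊗ t) ⇄₀ (r ⊗ (s ⊗ t))
  ⇄-dist  : ∀ {A r s} → ƛ A (r ⊗ s) ⇄₀ (ƛ A r ⊗ ƛ A s)
  ⇄-curry : ∀ {r s t} → (r · s · t) ⇄₀ (r · (s ⊗ t))

data _⇄_ : Tm → Tm → Set where
  ⇄-base : ∀ {r s} → r ⇄₀ s → r ⇄ s
  ⇄-sym  : ∀ {r s} → r ⇄ s → s ⇄ r
  ⇄-ƛ    : ∀ {A r s} → r ⇄ s → ƛ A r ⇄ ƛ A s
  ⇄-·l   : ∀ {r s t} → r ⇄ s → r · t ⇄ s · t
  ⇄-·r   : ∀ {r s t} → r ⇄ s → t · r ⇄ t · s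
  ⇄-⊗l   : ∀ {r s t} → r ⇄ s → r ⊗ t ⇄ s ⊗ t
  ⇄-⊗r   : ∀ {r s t} → r ⇄ s → t ⊗ r ⇄ t ⊗ s
  ⇄-π    : ∀ {A r s} → r ⇄ s → π A r ⇄ π A s

_⇄T_ : Tm → Tm → Set
r ⇄T s = Term r × Term s × r ⇄ s

_⇄*_ : Tm → Tm → Set
_⇄*_ = Star _⇄T_

data ElimOrVar : Tm → Set where
  ev-fv : ∀ {x} → ElimOrVar (fv x)
  ev-bv : ∀ {i} → ElimOrVar (bv i)
  ev-·  : ∀ {r s} → ElimOrVar (r · s)
  ev-π  : ∀ {A r} → ElimOrVar (π A r)

infix 4 _⊢_⟶βπζ_ _⊢_⟶ηδ_ _⊢_↪_ _⊢_⟶_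

data _⊢_⟶βπζ_ (Γ : Ctx) : Tm → Tm → Set where
  red-β : ∀ {A r s} → Γ ⊢ s ∶ A → Γ ⊢ ƛ A r · s ⟶βπζ r [ s ]
  red-π : ∀ {A r s} → Γ ⊢ r ∶ A → Γ ⊢ π A (r ⊗ s) ⟶βπζ r
  red-ζ : ∀ {r s t} → Γ ⊢ (r ⊗ s) · t ⟶βπζ (r · t) ⊗ (s · t)

-- η: the fresh variable x ∈ V_A is the new bound variable 0
data _⊢_⟶ηδ_ (Γ : Ctx) : Tm → Tm → Set where
  red-η : ∀ {A B r} → Γ ⊢ r ∶ A ⇒ B → ElimOrVar r →
          Γ ⊢ r ⟶ηδ ƛ A (shift 0 r · bv 0)
  red-δ : ∀ {A B r} → Γ ⊢ r ∶ A ∧ B → ElimOrVar r →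
          Γ ⊢ r ⟶ηδ π A r ⊗ π B r

mutual
  data _⊢_↪_ (Γ : Ctx) : Tm → Tm → Set where
    ↪-βπζ : ∀ {r s} → Γ ⊢ r ⟶βπζ s → Γ ⊢ r ↪ s
    ↪-ƛ   : ∀ {A r s} → (A ∷ Γ) ⊢ r ⟶ s → Γ ⊢ ƛ A r ↪ ƛ A s
    ↪-·l  : ∀ {r s t} → Γ ⊢ r ↪ s → Γ ⊢ r · t ↪ s · t
    ↪-·r  : ∀ {r s t} → Γ ⊢ r ⟶ s → Γ ⊢ t · r ↪ t · s
    ↪-⊗l  : ∀ {r s t} → Γ ⊢ r ⟶ s → Γ ⊢ r ⊗ t ↪ s ⊗ t
    ↪-⊗r  : ∀ {r s t} → Γ ⊢ r ⟶ s → Γ ⊢ t ⊗ r ↪ t ⊗ s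
    ↪-π   : ∀ {A r s} → Γ ⊢ r ↪ s → Γ ⊢ π A r ↪ π A s

  data _⊢_⟶_ (Γ : Ctx) : Tm → Tm → Set where
    ⟶-ηδ : ∀ {r s} → Γ ⊢ r ⟶ηδ s → Γ ⊢ r ⟶ s
    ⟶-↪  : ∀ {r s} → Γ ⊢ r ↪ s → Γ ⊢ r ⟶ s

infix 4 _⇝_
_⇝_ : Tm → Tm → Set
r ⇝ s = Term r × Term s ×
        Σ Tm (λ r' → Σ Tm (λ s' → r ⇄* r' × [] ⊢ r' ⟶ s' × s' ⇄* s))

SN : Tm → Set
SN r = Term r × ¬ (Σ (ℕ → Tm) (λ f → f 0 ≡ r × (∀ i → f i ⇝ f (suc i))))

module Submission where

-- Every term reachable from λx^A.r by ⇝ is a "tree of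
-- abstractions": a nest of products whose leaves are abstractions
-- λ^A.b.  Indeed ⇄ only reassociates/commutes such products or moves a
-- product in or out of a λ^A (⇄-dist), and no η/δ/β/π/ζ step applies
-- at the top of a tree, so a reduction takes place inside one leaf.
-- Instantiating every leaf at the free variable x, Φ(λ^A.b) = b[x],
-- turns each ⇝-step between trees into a ⇝-step between the images,
-- and Φ(λx^A.r) = r.  An infinite chain out of λx^A.r would therefore
-- give an infinite chain out of r.

open import Defs
open import Function using (_∘_)
open import Data.Nat using (ℕ; zero; suc; pred; _<ᵇ_; _≡ᵇ_; _+_; _<_; _≤_; z≤n; s≤s)
open import Data.Nat.Properties using (<-cmp; ≤-refl; ≤-trans; <⇒≤; >⇒≢; m≤m+n; ≤-<-trans; n≤1+n; ≤-pred)
open import Data.Bool using (true; false)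
open import Data.List using ([]; _∷_; _++_; length)
open import Data.Product using (Σ; _×_; _,_; proj₁; proj₂)
open import Data.Sum using (_⊎_; inj₁; inj₂)
open import Data.Empty using (⊥-elim)
open import Relation.Nullary using (yes; no)
open import Relation.Binary.PropositionalEquality using (_≡_; _≢_; refl; sym; trans; cong; cong₂) renaming (subst to transport)
open import Relation.Binary.Construct.Closure.ReflexiveTransitive using (ε; _◅_)
open import Relation.Binary.Construct.Closure.Reflexive using (ReflClosure) renaming (refl to stay; [_] to step; map to mapRefl)
open import Relation.Binary.Construct.Closure.Reflexive.Properties using () renaming (sym to reflClosure-sym)
open import Relation.Binary.Definitions using (tri<; tri≈; tri>)

Chain : (ℕ → Tm) → Set
Chain f = ∀ i → f i ⇝ f (suc i)

<ᵇ-true : ∀ {i k} → i < k → (i <ᵇ k) ≡ true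
<ᵇ-true {zero}  {suc k} _       = refl
<ᵇ-true {suc i} {suc k} (s≤s p) = <ᵇ-true p

<ᵇ-false : ∀ {i k} → k ≤ i → (i <ᵇ k) ≡ false
<ᵇ-false {i}     {zero}  _       = refl
<ᵇ-false {suc i} {suc k} (s≤s p) = <ᵇ-false p

≡ᵇ-refl : ∀ k → (k ≡ᵇ k) ≡ true
≡ᵇ-refl zero    = refl
≡ᵇ-refl (suc k) = ≡ᵇ-refl k

≡ᵇ-false : ∀ {i k} → i ≢ k → (i ≡ᵇ k) ≡ false
≡ᵇ-false {zero}  {zero}  p = ⊥-elim (p refl)
≡ᵇ-false {zero}  {suc k} p = refl
≡ᵇ-false {suc i} {zero}  p = refl
≡ᵇ-false {suc i} {suc k} p = ≡ᵇ-false (p ∘ cong suc)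

subst-bv-< : ∀ {i k} s → i < k → subst k s (bv i) ≡ bv i
subst-bv-< s p rewrite <ᵇ-true p = refl

subst-bv-≡ : ∀ k s → subst k s (bv k) ≡ shiftBy k s
subst-bv-≡ k s rewrite <ᵇ-false {k} {k} ≤-refl | ≡ᵇ-refl k = refl

subst-bv-> : ∀ {i k} s → k < i → subst k s (bv i) ≡ bv (pred i)
subst-bv-> s p rewrite <ᵇ-false (<⇒≤ p) | ≡ᵇ-false (>⇒≢ p) = refl

shift-bv-< : ∀ {i c} → i < c → shift c (bv i) ≡ bv i
shift-bv-< p rewrite <ᵇ-true p = refl

shift-bv-≥ : ∀ {i c} → c ≤ i → shift c (bv i) ≡ bv (suc i)
shift-bv-≥ p rewrite <ᵇ-false p = refl

shiftBy-fv : ∀ k y → shiftBy k (fv y) ≡ fv y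
shiftBy-fv zero    y = refl
shiftBy-fv (suc k) y rewrite shiftBy-fv k y = refl

subst-⇄ : ∀ k u {r s} → r ⇄ s → subst k u r ⇄ subst k u s
subst-⇄ k u (⇄-base ⇄-comm)  = ⇄-base ⇄-comm
subst-⇄ k u (⇄-base ⇄-assoc) = ⇄-base ⇄-assoc
subst-⇄ k u (⇄-base ⇄-dist)  = ⇄-base ⇄-dist
subst-⇄ k u (⇄-base ⇄-curry) = ⇄-base ⇄-curry
subst-⇄ k u (⇄-sym d)        = ⇄-sym (subst-⇄ k u d)
subst-⇄ k u (⇄-ƛ d)          = ⇄-ƛ (subst-⇄ (suc k) u d)
subst-⇄ k u (⇄-·l d)         = ⇄-·l (subst-⇄ k u d)
subst-⇄ k u (⇄-·r d)         = ⇄-·r (subst-⇄ k u d)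
subst-⇄ k u (⇄-⊗l d)         = ⇄-⊗l (subst-⇄ k u d)
subst-⇄ k u (⇄-⊗r d)         = ⇄-⊗r (subst-⇄ k u d)
subst-⇄ k u (⇄-π d)          = ⇄-π (subst-⇄ k u d)

prepend : ∀ {a b c} → Term a → Term b → ReflClosure _⇄_ a b → b ⇄* c → a ⇄* c
prepend _  _  stay     bc = bc
prepend Ta Tb (step p) bc = (Ta , Tb , p) ◅ bc

∋-< : ∀ {Γ i C} → Γ ∋ i ∶ C → i < length Γ
∋-< here      = s≤s z≤n
∋-< (there p) = s≤s (∋-< p)

module FreeVariable (y : Var) where

  v : Tm
  v = fv y

  subst-shift-bv : ∀ {c k i} → c ≤ i → c ≤ k →
                   subst (suc k) v (bv (suc i)) ≡ shift c (subst k v (bv i))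
  subst-shift-bv {c} {k} {i} c≤i c≤k with <-cmp i k
  ... | tri< i<k _ _ rewrite subst-bv-< v (s≤s i<k) | subst-bv-< v i<k | shift-bv-≥ c≤i = refl
  ... | tri≈ _ refl _ rewrite subst-bv-≡ (suc i) v | subst-bv-≡ i v | shiftBy-fv (suc i) y | shiftBy-fv i y = refl
  subst-shift-bv {c} {k} {suc i} c≤i c≤k | tri> _ _ k<i
    rewrite subst-bv-> v (s≤s k<i) | subst-bv-> v k<i | shift-bv-≥ {i} {c} (≤-trans c≤k (≤-pred k<i)) = refl

  subst-bv-suc : ∀ k i → subst (suc k) v (bv (suc i)) ≡ shift 0 (subst k v (bv i))
  subst-bv-suc k i = subst-shift-bv {0} {k} {i} z≤n z≤n

  subst-shift : ∀ {c k} r → c ≤ k → subst (suc k) v (shift c r) ≡ shift c (subst k v r)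
  subst-shift (fv z) p = refl
  subst-shift {c} {k} (bv i) p with <-cmp i c
  ... | tri< i<c _ _ rewrite shift-bv-< i<c | subst-bv-< v (≤-trans i<c (≤-trans p (n≤1+n k)))
                           | subst-bv-< v (≤-trans i<c p) | shift-bv-< i<c = refl
  ... | tri≈ _ refl _ rewrite shift-bv-≥ {i} {c} ≤-refl = subst-shift-bv ≤-refl p
  ... | tri> _ _ c<i rewrite shift-bv-≥ {i} {c} (<⇒≤ c<i) = subst-shift-bv (<⇒≤ c<i) p
  subst-shift (ƛ B r) p = cong (ƛ B) (subst-shift r (s≤s p))
  subst-shift (r · s) p = cong₂ _·_ (subst-shift r p) (subst-shift s p)
  subst-shift (r ⊗ s) p = cong₂ _⊗_ (subst-shift r p) (subst-shift s p)
  subst-shift (π B r) p = cong (π B) (subst-shift r p)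

  subst-shiftBy : ∀ j m s → subst (j + m) v (shiftBy j s) ≡ shiftBy j (subst m v s)
  subst-shiftBy zero    m s = refl
  subst-shiftBy (suc j) m s = trans (subst-shift (shiftBy j s) z≤n) (cong (shift 0) (subst-shiftBy j m s))

  subst-subst-bv : ∀ j m s i → subst (j + m) v (subst j s (bv i))
                             ≡ subst j (subst m v s) (subst (suc (j + m)) v (bv i))
  subst-subst-bv j m s i with <-cmp i j
  ... | tri< i<j _ _ rewrite subst-bv-< s i<j | subst-bv-< v (≤-trans i<j (m≤m+n j m))
                           | subst-bv-< v (≤-trans i<j (≤-trans (m≤m+n j m) (n≤1+n _)))
                           | subst-bv-< (subst m v s) i<j = refl
  ... | tri≈ _ refl _ rewrite subst-bv-≡ i s | subst-bv-< {i} {suc (i + m)} v (s≤s (m≤m+n i m))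
                            | subst-bv-≡ i (subst m v s) = subst-shiftBy i m s
  subst-subst-bv j m s (suc i) | tri> _ _ j<i rewrite subst-bv-> s j<i with <-cmp i (j + m)
  ... | tri< a _ _ rewrite subst-bv-< v a | subst-bv-< v (s≤s a) | subst-bv-> (subst m v s) j<i = refl
  ... | tri≈ _ refl _ rewrite subst-bv-≡ (j + m) v | subst-bv-≡ (suc (j + m)) v | shiftBy-fv (j + m) y = refl
  ... | tri> _ _ c rewrite subst-bv-> v c | subst-bv-> v (s≤s c)
                         | subst-bv-> (subst m v s) (≤-<-trans (m≤m+n j m) c) = refl

  subst-subst : ∀ j m s r → subst (j + m) v (subst j s r) ≡ subst j (subst m v s) (subst (suc (j + m)) v r)
  subst-subst j m s (fv z)  = refl
  subst-subst j m s (bv i)  = subst-subst-bv j m s i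
  subst-subst j m s (ƛ B r) = cong (ƛ B) (subst-subst (suc j) m s r)
  subst-subst j m s (r · t) = cong₂ _·_ (subst-subst j m s r) (subst-subst j m s t)
  subst-subst j m s (r ⊗ t) = cong₂ _⊗_ (subst-subst j m s r) (subst-subst j m s t)
  subst-subst j m s (π B r) = cong (π B) (subst-subst j m s r)

  subst-ElimOrVar : ∀ k t → ElimOrVar t → ElimOrVar (subst k v t)
  subst-ElimOrVar k _ ev-fv = ev-fv
  subst-ElimOrVar k (bv i) ev-bv with i <ᵇ k
  ... | true = ev-bv
  ... | false with i ≡ᵇ k
  ... | true rewrite shiftBy-fv k y = ev-fv
  ... | false = ev-bv
  subst-ElimOrVar k _ ev-· = ev-·
  subst-ElimOrVar k _ ev-π = ev-π

  open-close : ∀ Γ {r C} → Γ ⊢ r ∶ C → subst (length Γ) v (close (length Γ) y r) ≡ r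
  open-close Γ (ty-fv {z} p) with z ≟V y
  ... | yes refl = trans (subst-bv-≡ (length Γ) v) (shiftBy-fv (length Γ) y)
  ... | no _     = refl
  open-close Γ (ty-bv p)        = subst-bv-< v (∋-< p)
  open-close Γ (ty-conv d e)    = open-close Γ d
  open-close Γ (ty-ƛ {A = B} d) = cong (ƛ B) (open-close (B ∷ Γ) d)
  open-close Γ (ty-· d e)       = cong₂ _·_ (open-close Γ d) (open-close Γ e)
  open-close Γ (ty-⊗ d e)       = cong₂ _⊗_ (open-close Γ d) (open-close Γ e)
  open-close Γ (ty-π d)         = cong (π _) (open-close Γ d)

module TypedFreeVariable (A : Ty) (y : Var) (y∈A : y ∈V A) where

  open FreeVariable y public

  lookup-subst : ∀ (Δ : Ctx) {Γ i C} → (Δ ++ A ∷ Γ) ∋ i ∶ C →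
                 (subst (length Δ) v (bv i) ≡ v × C ≡ A)
                 ⊎ Σ ℕ (λ j → subst (length Δ) v (bv i) ≡ bv j × (Δ ++ Γ) ∋ j ∶ C)
  lookup-subst []      here                = inj₁ (refl , refl)
  lookup-subst []      (there {i = i} p)   = inj₂ (i , refl , p)
  lookup-subst (B ∷ Δ) here                = inj₂ (0 , refl , here)
  lookup-subst (B ∷ Δ) (there {i = i} p) with lookup-subst Δ p
  ... | inj₁ (e , c)     = inj₁ (trans (subst-bv-suc (length Δ) i) (cong (shift 0) e) , c)
  ... | inj₂ (j , e , q) = inj₂ (suc j , trans (subst-bv-suc (length Δ) i) (cong (shift 0) e) , there q)

  subst-typing : ∀ (Δ : Ctx) {Γ t C} → (Δ ++ A ∷ Γ) ⊢ t ∶ C → (Δ ++ Γ) ⊢ subst (length Δ) v t ∶ C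
  subst-typing Δ (ty-fv p) = ty-fv p
  subst-typing Δ (ty-bv p) with lookup-subst Δ p
  ... | inj₁ (e , refl)  rewrite e = ty-fv y∈A
  ... | inj₂ (j , e , q) rewrite e = ty-bv q
  subst-typing Δ (ty-conv d e)    = ty-conv (subst-typing Δ d) e
  subst-typing Δ (ty-ƛ {A = B} d) = ty-ƛ (subst-typing (B ∷ Δ) d)
  subst-typing Δ (ty-· d e)       = ty-· (subst-typing Δ d) (subst-typing Δ e)
  subst-typing Δ (ty-⊗ d e)       = ty-⊗ (subst-typing Δ d) (subst-typing Δ e)
  subst-typing Δ (ty-π d)         = ty-π (subst-typing Δ d)

  mutual
    subst-⟶ : ∀ (Δ : Ctx) {Γ t t'} → (Δ ++ A ∷ Γ) ⊢ t ⟶ t' →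
              (Δ ++ Γ) ⊢ subst (length Δ) v t ⟶ subst (length Δ) v t'
    subst-⟶ Δ (⟶-ηδ (red-η {A = B} {r = r} d e)) =
      transport (λ z → _ ⊢ subst (length Δ) v r ⟶ ƛ B (z · bv 0)) (sym (subst-shift r z≤n))
        (⟶-ηδ (red-η (subst-typing Δ d) (subst-ElimOrVar _ r e)))
    subst-⟶ Δ (⟶-ηδ (red-δ {r = r} d e)) = ⟶-ηδ (red-δ (subst-typing Δ d) (subst-ElimOrVar _ r e))
    subst-⟶ Δ (⟶-↪ d) = ⟶-↪ (subst-↪ Δ d)

    subst-↪ : ∀ (Δ : Ctx) {Γ t t'} → (Δ ++ A ∷ Γ) ⊢ t ↪ t' →
              (Δ ++ Γ) ⊢ subst (length Δ) v t ↪ subst (length Δ) v t'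
    subst-↪ Δ (↪-βπζ (red-β {r = r} {s = s} d)) =
      transport (λ z → _ ⊢ subst (length Δ) v (ƛ _ r · s) ↪ z) (sym (subst-subst 0 (length Δ) s r))
        (↪-βπζ (red-β {r = subst (suc (length Δ)) v r} (subst-typing Δ d)))
    subst-↪ Δ (↪-βπζ (red-π d))  = ↪-βπζ (red-π (subst-typing Δ d))
    subst-↪ Δ (↪-βπζ red-ζ)      = ↪-βπζ red-ζ
    subst-↪ Δ (↪-ƛ {A = B} d)    = ↪-ƛ (subst-⟶ (B ∷ Δ) d)
    subst-↪ Δ (↪-·l d)           = ↪-·l (subst-↪ Δ d)
    subst-↪ Δ (↪-·r d)           = ↪-·r (subst-⟶ Δ d)
    subst-↪ Δ (↪-⊗l d)           = ↪-⊗l (subst-⟶ Δ d)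
    subst-↪ Δ (↪-⊗r d)           = ↪-⊗r (subst-⟶ Δ d)
    subst-↪ Δ (↪-π d)            = ↪-π (subst-↪ Δ d)

  close-typing : ∀ Γ {r C} → Γ ⊢ r ∶ C → (Γ ++ A ∷ []) ⊢ close (length Γ) y r ∶ C
  close-typing Γ (ty-fv {z} p) with z ≟V y
  ... | yes refl = ty-conv (ty-bv (last Γ)) (≈-trans (≈-sym y∈A) p)
    where last : ∀ Γ → (Γ ++ A ∷ []) ∋ length Γ ∶ A
          last []      = here
          last (B ∷ Γ) = there (last Γ)
  ... | no _     = ty-fv p
  close-typing Γ (ty-bv p)        = ty-bv (weaken p)
    where weaken : ∀ {Γ i C} → Γ ∋ i ∶ C → (Γ ++ A ∷ []) ∋ i ∶ C
          weaken here      = here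
          weaken (there p) = there (weaken p)
  close-typing Γ (ty-conv d e)    = ty-conv (close-typing Γ d) e
  close-typing Γ (ty-ƛ {A = B} d) = ty-ƛ (close-typing (B ∷ Γ) d)
  close-typing Γ (ty-· d e)       = ty-· (close-typing Γ d) (close-typing Γ e)
  close-typing Γ (ty-⊗ d e)       = ty-⊗ (close-typing Γ d) (close-typing Γ e)
  close-typing Γ (ty-π d)         = ty-π (close-typing Γ d)

module AbstractionTrees (A : Ty) (y : Var) (y∈A : y ∈V A) where

  open TypedFreeVariable A y y∈A public

  data Tree : Tm → Set where
    leaf : ∀ {b} → Tree (ƛ A b)
    node : ∀ {t u} → Tree t → Tree u → Tree (t ⊗ u)

  Φ : Tm → Tm
  Φ (ƛ _ b) = b [ v ]
  Φ (t ⊗ u) = Φ t ⊗ Φ u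
  Φ t       = t

  -- One ⇄ step between t and t' is at most one ⇄ step between Φ t and Φ t'
  -- (⇄-dist becomes an equality).
  Φ-⇄ : ∀ {t t'} → t ⇄ t' → ReflClosure _⇄_ (Φ t) (Φ t')
  Φ-⇄ (⇄-base ⇄-comm)  = step (⇄-base ⇄-comm)
  Φ-⇄ (⇄-base ⇄-assoc) = step (⇄-base ⇄-assoc)
  Φ-⇄ (⇄-base ⇄-dist)  = stay
  Φ-⇄ (⇄-base ⇄-curry) = step (⇄-base ⇄-curry)
  Φ-⇄ (⇄-sym d)        = reflClosure-sym ⇄-sym (Φ-⇄ d)
  Φ-⇄ (⇄-ƛ d)  = step (subst-⇄ 0 v d)
  Φ-⇄ (⇄-·l d) = step (⇄-·l d)
  Φ-⇄ (⇄-·r d) = step (⇄-·r d)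
  Φ-⇄ (⇄-⊗l d) = mapRefl ⇄-⊗l (Φ-⇄ d)
  Φ-⇄ (⇄-⊗r d) = mapRefl ⇄-⊗r (Φ-⇄ d)
  Φ-⇄ (⇄-π d)  = step (⇄-π d)

  Tree-⇄ : ∀ {t t'} → t ⇄ t' → (Tree t → Tree t') × (Tree t' → Tree t)
  Tree-⇄ (⇄-base ⇄-comm)  = (λ { (node a b) → node b a }) , (λ { (node b a) → node a b })
  Tree-⇄ (⇄-base ⇄-assoc) = (λ { (node (node a b) c) → node a (node b c) })
                          , (λ { (node a (node b c)) → node (node a b) c })
  Tree-⇄ (⇄-base ⇄-dist)  = (λ { leaf → node leaf leaf }) , (λ { (node leaf leaf) → leaf })
  Tree-⇄ (⇄-base ⇄-curry) = (λ ()) , (λ ())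
  Tree-⇄ (⇄-sym d)        = proj₂ (Tree-⇄ d) , proj₁ (Tree-⇄ d)
  Tree-⇄ (⇄-ƛ d)          = (λ { leaf → leaf }) , (λ { leaf → leaf })
  Tree-⇄ (⇄-·l d)         = (λ ()) , (λ ())
  Tree-⇄ (⇄-·r d)         = (λ ()) , (λ ())
  Tree-⇄ (⇄-⊗l d)         = (λ { (node a b) → node (proj₁ (Tree-⇄ d) a) b })
                          , (λ { (node a b) → node (proj₂ (Tree-⇄ d) a) b })
  Tree-⇄ (⇄-⊗r d)         = (λ { (node a b) → node a (proj₁ (Tree-⇄ d) b) })
                          , (λ { (node a b) → node a (proj₂ (Tree-⇄ d) b) })
  Tree-⇄ (⇄-π d)          = (λ ()) , (λ ())

  Φ-typing : ∀ {t C} → Tree t → [] ⊢ t ∶ C → Term (Φ t)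
  Φ-typing tr         (ty-conv d _) = Φ-typing tr d
  Φ-typing leaf       (ty-ƛ {B = B} d) = B , subst-typing [] d
  Φ-typing (node a b) (ty-⊗ d e) = _ , ty-⊗ (proj₂ (Φ-typing a d)) (proj₂ (Φ-typing b e))

  Φ-term : ∀ {t} → Tree t → Term t → Term (Φ t)
  Φ-term tr (_ , d) = Φ-typing tr d

  Φ-⇄* : ∀ {t t'} → t ⇄* t' → Tree t → Tree t' × (Φ t ⇄* Φ t')
  Φ-⇄* ε tr = tr , ε
  Φ-⇄* ((Tt , Tt' , d) ◅ rest) tr with proj₁ (Tree-⇄ d) tr
  ... | tr' with Φ-⇄* rest tr'
  ... | tr'' , st = tr'' , prepend (Φ-term tr Tt) (Φ-term tr' Tt') (Φ-⇄ d) st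

  -- A tree is neither an elimination nor a variable and has no redex at
  -- its root, so it reduces inside a leaf; Φ carries this to the instance.
  Φ-⟶ : ∀ {t t'} → [] ⊢ t ⟶ t' → Tree t → Tree t' × ([] ⊢ Φ t ⟶ Φ t')
  Φ-⟶ (⟶-ηδ (red-η _ ())) leaf
  Φ-⟶ (⟶-ηδ (red-η _ ())) (node _ _)
  Φ-⟶ (⟶-ηδ (red-δ _ ())) leaf
  Φ-⟶ (⟶-ηδ (red-δ _ ())) (node _ _)
  Φ-⟶ (⟶-↪ (↪-ƛ d)) leaf = leaf , subst-⟶ [] d
  Φ-⟶ (⟶-↪ (↪-⊗l d)) (node a b) with Φ-⟶ d a
  ... | a' , e = node a' b , ⟶-↪ (↪-⊗l e)
  Φ-⟶ (⟶-↪ (↪-⊗r d)) (node a b) with Φ-⟶ d b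
  ... | b' , e = node a b' , ⟶-↪ (↪-⊗r e)

  Φ-⇝ : ∀ {t u} → Tree t → t ⇝ u → Tree u × (Φ t ⇝ Φ u)
  Φ-⇝ tr (Tt , Tu , r' , s' , st₁ , d , st₂) with Φ-⇄* st₁ tr
  ... | tr₁ , st₁' with Φ-⟶ d tr₁
  ... | tr₂ , d' with Φ-⇄* st₂ tr₂
  ... | tr₃ , st₂' = tr₃ , (Φ-term tr Tt , Φ-term tr₃ Tu , Φ r' , Φ s' , st₁' , d' , st₂')

  trees-along : ∀ f → Tree (f 0) → Chain f → ∀ i → Tree (f i)
  trees-along f tr₀ chain zero    = tr₀
  trees-along f tr₀ chain (suc i) = proj₁ (Φ-⇝ (trees-along f tr₀ chain i) (chain i))

  Φ-chain : ∀ f → Tree (f 0) → Chain f → Chain (Φ ∘ f)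
  Φ-chain f tr₀ chain i = proj₂ (Φ-⇝ (trees-along f tr₀ chain i) (chain i))

mainTheorem13 : (A : Ty) (x : Var) (r : Tm) → x ∈V A → SN r → SN (ƛ A (close 0 x r))
mainTheorem13 A x r x∈A ((C , ⊢r) , r-has-no-chain) =
  (A ⇒ C , ty-ƛ (close-typing [] ⊢r)) , λ (f , f₀≡λxr , chain) →
    r-has-no-chain (Φ ∘ f , Φf₀≡r f f₀≡λxr , Φ-chain f (transport Tree (sym f₀≡λxr) leaf) chain)
  where
    open AbstractionTrees A x x∈A
    Φf₀≡r : ∀ f → f 0 ≡ ƛ A (close 0 x r) → Φ (f 0) ≡ r
    Φf₀≡r f f₀≡λxr = trans (cong Φ f₀≡λxr) (open-close [] ⊢r)
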